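{- For all integers $n\ge k\ge 0$, the set of forms $\{(\mathcal F_0(\pi),\mathcal F_1(\pi),\dots,\mathcal F_n(\pi)) : \pi\in\mathcal{OP}_n^k\}$ is exactly the set $\Omega_n^k$ of paths of depth $k$ and length $n$ in $D_k$.
   Context: An ordered partition of $[n]$ into $k$ blocks is a sequence $\pi=(B_1,\dots,B_k)$ of nonempty pairwise disjoint sets with union $[n]$; $\mathcal{OP}_n^k$ is the set of these. For $0\le i\le n$, the $i$-th trace $T_i(\pi)$ is the sequence of the nonempty sets among $B_1\cap[i],\dots,B_k\cap[i]$ in this order; such a set $B_j\cap[i]$ is closed if $B_j\subseteq[i]$ and opened otherwise. Let $\mathrm{cl}_i(\pi)$ and $\mathrm{op}_i(\pi)$ be the numbers of closed and opened sets in $T_i(\pi)$, and $\mathcal F_i(\pi)=(\mathrm{cl}_i(\pi),\mathrm{op}_i(\pi))$ (so $\mathcal F_0(\pi)=(0,0)$); the sequence $(\mathcal F_i(\pi))_{0\le i\le n}$ is the form of $\pi$. For $k\ge0$, $D_k$ is the digraph with vertex set $\{(i,j)\in\mathbb N^2: i+j\le k\}$ and an edge from $(i,j)$ to $(i',j')$ iff either $(i',j')=(i,j)$ with $j>0$, or $(i',j')\in\{(i,j+1),(i+1,j),(i+1,j-1)\}$ (and $(i',j')$ is a vertex). A path of depth $k$ and length $n$ is a sequence $(s_0,\dots,s_n)$ of vertices of $D_k$ with $s_0=(0,0)$, $s_n=(k,0)$, and $(s_{i-1},s_i)$ an edge for all $i$; $\Omega_n^k$ is the set of these. -}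

module Defs where

open import Data.Nat using (ℕ; zero; suc; _+_; _≤_; _<_; _<ᵇ_)
open import Data.Bool using (Bool; true; false; _∧_; _∨_; not)
open import Data.Fin using (Fin; toℕ; inject₁)
open import Data.Fin.Subset using (Subset; _∈_; _∉_; Nonempty)
open import Data.Vec using (Vec; lookup; tabulate; head; last)
open import Data.List using (List; length; filterᵇ; allFin)
open import Data.Bool.ListAction using (any; all)
open import Data.Product using (_×_; _,_; ∃; proj₁; proj₂)
open import Data.Sum using (_⊎_)
open import Relation.Binary.PropositionalEquality using (_≡_; _≢_)

-- Convention: the element x : Fin n of [n] stands for the number toℕ x + 1,
-- so "x ∈ [i]" means toℕ x < i.

record OrderedPartition (n k : ℕ) : Set where
  field
    block    : Fin k → Subset n
    nonempty : ∀ j → Nonempty (block j)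
    disjoint : ∀ j j' → j ≢ j' → ∀ x → x ∈ block j → x ∉ block j'
    covers   : ∀ x → ∃ λ j → x ∈ block j
open OrderedPartition public

inPrefix : ∀ {n} → ℕ → Fin n → Bool
inPrefix i x = toℕ x <ᵇ i

meetsPrefix : ∀ {n} → ℕ → Subset n → Bool
meetsPrefix {n} i S = any (λ x → inPrefix i x ∧ lookup S x) (allFin n)

withinPrefix : ∀ {n} → ℕ → Subset n → Bool
withinPrefix {n} i S = all (λ x → not (lookup S x) ∨ inPrefix i x) (allFin n)

isClosedAt : ∀ {n} → ℕ → Subset n → Bool
isClosedAt i S = meetsPrefix i S ∧ withinPrefix i S

isOpenedAt : ∀ {n} → ℕ → Subset n → Bool
isOpenedAt i S = meetsPrefix i S ∧ not (withinPrefix i S)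

cl : ∀ {n k} → ℕ → OrderedPartition n k → ℕ
cl {n} {k} i π = length (filterᵇ (λ j → isClosedAt i (block π j)) (allFin k))

op : ∀ {n k} → ℕ → OrderedPartition n k → ℕ
op {n} {k} i π = length (filterᵇ (λ j → isOpenedAt i (block π j)) (allFin k))

F : ∀ {n k} → ℕ → OrderedPartition n k → ℕ × ℕ
F i π = cl i π , op i π

form : ∀ {n k} → OrderedPartition n k → Vec (ℕ × ℕ) (suc n)
form {n} π = tabulate (λ (i : Fin (suc n)) → F (toℕ i) π)

Vertex : ℕ → ℕ × ℕ → Set
Vertex k (i , j) = i + j ≤ k

data Step : ℕ × ℕ → ℕ × ℕ → Set where
  loop  : ∀ {i j} → Step (i , suc j) (i , suc j)
  open′ : ∀ {i j} → Step (i , j) (i , suc j)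
  new   : ∀ {i j} → Step (i , j) (suc i , j)
  close : ∀ {i j} → Step (i , suc j) (suc i , j)

Edge : ℕ → ℕ × ℕ → ℕ × ℕ → Set
Edge k s t = Vertex k s × Vertex k t × Step s t

IsPath : (k n : ℕ) → Vec (ℕ × ℕ) (suc n) → Set
IsPath k n s =
  (∀ (i : Fin (suc n)) → Vertex k (lookup s i)) ×
  (head s ≡ (0 , 0)) ×
  (last s ≡ (k , 0)) ×
  (∀ (i : Fin n) → Edge k (lookup s (inject₁ i)) (lookup s (Data.Fin.suc i)))

-- Going from the trace T_i to T_{i+1} only affects the block B that contains i+1: whether B
-- already meets [i] and whether B ⊆ [i+1] decide which of the four edges of D_k the pair
-- (cl, op) follows, while every other block keeps its status; and cl + op ≤ k because closed
-- and opened sets come from distinct blocks.  Conversely a path is realised greedily: a step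
-- that increases cl + op starts a block with the next number, any other step puts i+1 into a
-- block that is still open (one exists, since op > 0 before such a step), and a step that
-- increases cl marks that block finished.  Ending at (k , 0) means that exactly k blocks were
-- started and none is left open.

module Submission where

open import Defs
open import Data.Bool using (Bool; true; false; _∧_; _∨_; not; if_then_else_)
open import Data.Bool.Properties using (∧-zeroʳ; ∧-identityʳ; ∨-zeroʳ)
open import Data.Bool.ListAction using (any; all; or; and)
open import Data.Fin as Fin using (Fin; toℕ; fromℕ; fromℕ<; inject₁)
open import Data.Fin.Properties using (toℕ-injective; toℕ<n; toℕ-fromℕ<; toℕ-inject₁; toℕ-fromℕ)
  renaming (suc-injective to Fin-suc-injective)
open import Data.Fin.Subset using (Subset; _∈_; _∉_)
open import Data.List as List using (length; filterᵇ; allFin)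
open import Data.List.Properties using (map-cong)
open import Data.List.Relation.Unary.Any using (Any; here; there)
open import Data.List.Membership.Propositional.Properties using (∈-allFin)
open import Data.Nat using (ℕ; zero; suc; _+_; _≤_; _<_; _<ᵇ_; _≡ᵇ_; z≤n; s≤s; _<?_; _≟_)
open import Data.Nat.Properties
open import Algebra.Properties.CommutativeSemigroup +-commutativeSemigroup using (x∙yz≈y∙xz)
open import Data.Product using (_×_; _,_; ∃; proj₁; proj₂)
open import Data.Sum using (_⊎_; inj₁; inj₂)
open import Data.Vec using (Vec; lookup; tabulate; head; last; _∷_; [])
open import Data.Vec.Properties using ([]=⇒lookup; lookup⇒[]=; lookup∘tabulate; tabulate-cong; tabulate∘lookup)
open import Function using (_∘_; id; flip)
open import Function.Bundles using (_⇔_; mk⇔)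
open import Relation.Nullary using (¬_; yes; no; does; contradiction)
open import Relation.Nullary.Decidable using (dec-true; dec-false)
open import Relation.Binary.PropositionalEquality using (_≡_; _≢_; refl; sym; trans; cong; cong₂; subst; subst₂; module ≡-Reasoning)

bit : Bool → ℕ
bit true = 1
bit false = 0

<ᵇ-true : ∀ {m n} → m < n → (m <ᵇ n) ≡ true
<ᵇ-true {m} {n} = dec-true (m <? n)

<ᵇ-false : ∀ {m n} → ¬ m < n → (m <ᵇ n) ≡ false
<ᵇ-false {m} {n} = dec-false (m <? n)

≡ᵇ-true : ∀ {m n} → m ≡ n → (m ≡ᵇ n) ≡ true
≡ᵇ-true {m} {n} = dec-true (m ≟ n)

≡ᵇ-false : ∀ {m n} → m ≢ n → (m ≡ᵇ n) ≡ false
≡ᵇ-false {m} {n} = dec-false (m ≟ n)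

<ᵇ-suc : ∀ {m i} → m ≢ i → (m <ᵇ suc i) ≡ (m <ᵇ i)
<ᵇ-suc {m} {i} m≢i with m <? i
... | yes m<i = trans (<ᵇ-true (m<n⇒m<1+n m<i)) (sym (<ᵇ-true m<i))
... | no m≮i = trans (<ᵇ-false (λ m<1+i → m≮i (≤∧≢⇒< (m<1+n⇒m≤n m<1+i) m≢i))) (sym (<ᵇ-false m≮i))

∉⇒lookup : ∀ {n} {S : Subset n} {x} → x ∉ S → lookup S x ≡ false
∉⇒lookup {S = S} {x} x∉S with lookup S x in eq
... | true = contradiction (lookup⇒[]= x S eq) x∉S
... | false = refl

count : ∀ {k} → (Fin k → Bool) → ℕ
count {zero} f = 0
count {suc k} f = bit (f Fin.zero) + count (f ∘ Fin.suc)

length-filterᵇ-tabulate : ∀ {k m} (f : Fin m → Bool) (g : Fin k → Fin m) →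
  length (filterᵇ f (List.tabulate g)) ≡ count (f ∘ g)
length-filterᵇ-tabulate {zero} f g = refl
length-filterᵇ-tabulate {suc k} f g with f (g Fin.zero)
... | true = cong suc (length-filterᵇ-tabulate f (g ∘ Fin.suc))
... | false = length-filterᵇ-tabulate f (g ∘ Fin.suc)

count-cong : ∀ {k} {f g : Fin k → Bool} → (∀ j → f j ≡ g j) → count f ≡ count g
count-cong {zero} f≗g = refl
count-cong {suc k} f≗g = cong₂ _+_ (cong bit (f≗g Fin.zero)) (count-cong (f≗g ∘ Fin.suc))

count-swap : ∀ {k} (f g : Fin k → Bool) (j₀ : Fin k) → (∀ j → j ≢ j₀ → f j ≡ g j) →
  bit (g j₀) + count f ≡ bit (f j₀) + count g
count-swap f g Fin.zero f≗g = begin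
  bit (g Fin.zero) + (bit (f Fin.zero) + count (f ∘ Fin.suc))
    ≡⟨ cong (λ c → bit (g Fin.zero) + (bit (f Fin.zero) + c)) (count-cong (λ j → f≗g (Fin.suc j) λ ())) ⟩
  bit (g Fin.zero) + (bit (f Fin.zero) + count (g ∘ Fin.suc))
    ≡⟨ x∙yz≈y∙xz (bit (g Fin.zero)) (bit (f Fin.zero)) (count (g ∘ Fin.suc)) ⟩
  bit (f Fin.zero) + (bit (g Fin.zero) + count (g ∘ Fin.suc)) ∎
  where open ≡-Reasoning
count-swap f g (Fin.suc j₀) f≗g = begin
  bit (g (Fin.suc j₀)) + (bit (f Fin.zero) + count (f ∘ Fin.suc))
    ≡⟨ x∙yz≈y∙xz (bit (g (Fin.suc j₀))) (bit (f Fin.zero)) (count (f ∘ Fin.suc)) ⟩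
  bit (f Fin.zero) + (bit (g (Fin.suc j₀)) + count (f ∘ Fin.suc))
    ≡⟨ cong₂ _+_ (cong bit (f≗g Fin.zero λ ()))
                 (count-swap (f ∘ Fin.suc) (g ∘ Fin.suc) j₀ (λ j j≢j₀ → f≗g (Fin.suc j) (j≢j₀ ∘ Fin-suc-injective))) ⟩
  bit (g Fin.zero) + (bit (f (Fin.suc j₀)) + count (g ∘ Fin.suc))
    ≡⟨ x∙yz≈y∙xz (bit (g Fin.zero)) (bit (f (Fin.suc j₀))) (count (g ∘ Fin.suc)) ⟩
  bit (f (Fin.suc j₀)) + (bit (g Fin.zero) + count (g ∘ Fin.suc)) ∎
  where open ≡-Reasoning

count-snoc : ∀ {k} (f : Fin (suc k) → Bool) → count f ≡ count (f ∘ inject₁) + bit (f (fromℕ k))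
count-snoc {zero} f = +-comm (bit (f Fin.zero)) 0
count-snoc {suc k} f =
  trans (cong (bit (f Fin.zero) +_) (count-snoc (f ∘ Fin.suc))) (sym (+-assoc (bit (f Fin.zero)) _ _))

witness⇒count>0 : ∀ {k} (f : Fin k → Bool) j → f j ≡ true → 0 < count f
witness⇒count>0 f Fin.zero fj rewrite fj = s≤s z≤n
witness⇒count>0 f (Fin.suc j) fj = ≤-trans (witness⇒count>0 (f ∘ Fin.suc) j fj) (m≤n+m _ (bit (f Fin.zero)))

count>0⇒witness : ∀ {k} (f : Fin k → Bool) → 0 < count f → ∃ λ j → f j ≡ true
count>0⇒witness {suc k} f count>0 with f Fin.zero in f₀
... | true = Fin.zero , f₀
... | false with count>0⇒witness (f ∘ Fin.suc) count>0
...   | j , fj = Fin.suc j , fj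

count≡0⇒false : ∀ {k} (f : Fin k → Bool) → count f ≡ 0 → ∀ j → f j ≡ false
count≡0⇒false f count≡0 j with f j in fj
... | true = contradiction (subst (0 <_) count≡0 (witness⇒count>0 f j fj)) (λ ())
... | false = refl

count-false : ∀ {k} (f : Fin k → Bool) → (∀ j → f j ≡ false) → count f ≡ 0
count-false {zero} f f≡false = refl
count-false {suc k} f f≡false rewrite f≡false Fin.zero = count-false (f ∘ Fin.suc) (f≡false ∘ Fin.suc)

count-true : ∀ {k} (f : Fin k → Bool) → (∀ j → f j ≡ true) → count f ≡ k
count-true {zero} f f≡true = refl
count-true {suc k} f f≡true rewrite f≡true Fin.zero = cong suc (count-true (f ∘ Fin.suc) (f≡true ∘ Fin.suc))

count-disjoint : ∀ {k} (f g : Fin k → Bool) → (∀ j → f j ∧ g j ≡ false) → count f + count g ≤ k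
count-disjoint {zero} f g disj = z≤n
count-disjoint {suc k} f g disj
  with f Fin.zero | g Fin.zero | disj Fin.zero | count-disjoint (f ∘ Fin.suc) (g ∘ Fin.suc) (disj ∘ Fin.suc)
... | false | false | _ | ih = m≤n⇒m≤1+n ih
... | true  | false | _ | ih = s≤s ih
... | false | true  | _ | ih = subst (_≤ suc k) (sym (+-suc (count (f ∘ Fin.suc)) _)) (s≤s ih)

module _ {A : Set} (p : A → Bool) where

  any-true : ∀ xs {x} → Any (x ≡_) xs → p x ≡ true → any p xs ≡ true
  any-true (y List.∷ ys) (here refl) px rewrite px = refl
  any-true (y List.∷ ys) (there x∈ys) px rewrite any-true ys x∈ys px = ∨-zeroʳ (p y)

  any-false : ∀ xs → (∀ x → p x ≡ false) → any p xs ≡ false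
  any-false List.[] p≡false = refl
  any-false (y List.∷ ys) p≡false rewrite p≡false y = any-false ys p≡false

  all-true : ∀ xs → (∀ x → p x ≡ true) → all p xs ≡ true
  all-true List.[] p≡true = refl
  all-true (y List.∷ ys) p≡true rewrite p≡true y = all-true ys p≡true

  all-false : ∀ xs {x} → Any (x ≡_) xs → p x ≡ false → all p xs ≡ false
  all-false (y List.∷ ys) (here refl) px rewrite px = refl
  all-false (y List.∷ ys) (there x∈ys) px rewrite all-false ys x∈ys px = ∧-zeroʳ (p y)

module _ {n : ℕ} (S : Subset n) where

  meetsPrefix-intro : ∀ {i} x → toℕ x < i → x ∈ S → meetsPrefix i S ≡ true
  meetsPrefix-intro x x<i x∈S =
    any-true _ (allFin n) (∈-allFin x) (cong₂ _∧_ (<ᵇ-true x<i) ([]=⇒lookup x∈S))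

  meetsPrefix-none : ∀ {i} → (∀ x → toℕ x < i → x ∉ S) → meetsPrefix i S ≡ false
  meetsPrefix-none {i} outside = any-false _ (allFin n) miss
    where
    miss : ∀ x → (inPrefix i x ∧ lookup S x) ≡ false
    miss x with toℕ x <? i
    ... | yes x<i = trans (cong (inPrefix i x ∧_) (∉⇒lookup (outside x x<i))) (∧-zeroʳ _)
    ... | no x≮i = cong (_∧ lookup S x) (<ᵇ-false x≮i)

  withinPrefix-intro : ∀ {i} → (∀ x → x ∈ S → toℕ x < i) → withinPrefix i S ≡ true
  withinPrefix-intro {i} inside = all-true _ (allFin n) hit
    where
    hit : ∀ x → (not (lookup S x) ∨ inPrefix i x) ≡ true
    hit x with lookup S x in Sx
    ... | true = <ᵇ-true (inside x (lookup⇒[]= x S Sx))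
    ... | false = refl

  withinPrefix-escape : ∀ {i} x → i ≤ toℕ x → x ∈ S → withinPrefix i S ≡ false
  withinPrefix-escape x i≤x x∈S =
    all-false _ (allFin n) (∈-allFin x) (cong₂ (λ b c → not b ∨ c) ([]=⇒lookup x∈S) (<ᵇ-false (≤⇒≯ i≤x)))

  module _ {i : ℕ} (x : Fin n) (x≡i : toℕ x ≡ i) where

    meetsPrefix-∈ : x ∈ S → meetsPrefix (suc i) S ≡ true
    meetsPrefix-∈ = meetsPrefix-intro x (s≤s (≤-reflexive x≡i))

    withinPrefix-∈ : x ∈ S → withinPrefix i S ≡ false
    withinPrefix-∈ = withinPrefix-escape x (≤-reflexive (sym x≡i))

    ∉-or-prefix-suc : x ∉ S → ∀ y → lookup S y ≡ false ⊎ inPrefix (suc i) y ≡ inPrefix i y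
    ∉-or-prefix-suc x∉S y with toℕ y ≟ i
    ... | yes y≡i rewrite toℕ-injective {i = y} {j = x} (trans y≡i (sym x≡i)) = inj₁ (∉⇒lookup x∉S)
    ... | no y≢i = inj₂ (<ᵇ-suc y≢i)

    meetsPrefix-∉ : x ∉ S → meetsPrefix (suc i) S ≡ meetsPrefix i S
    meetsPrefix-∉ x∉S = cong or (map-cong same (allFin n))
      where
      same : ∀ y → (inPrefix (suc i) y ∧ lookup S y) ≡ (inPrefix i y ∧ lookup S y)
      same y with ∉-or-prefix-suc x∉S y
      ... | inj₁ Sy rewrite Sy = trans (∧-zeroʳ _) (sym (∧-zeroʳ _))
      ... | inj₂ step = cong (_∧ lookup S y) step

    withinPrefix-∉ : x ∉ S → withinPrefix (suc i) S ≡ withinPrefix i S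
    withinPrefix-∉ x∉S = cong and (map-cong same (allFin n))
      where
      same : ∀ y → (not (lookup S y) ∨ inPrefix (suc i) y) ≡ (not (lookup S y) ∨ inPrefix i y)
      same y with ∉-or-prefix-suc x∉S y
      ... | inj₁ Sy rewrite Sy = refl
      ... | inj₂ step = cong (not (lookup S y) ∨_) step

    isClosedAt-∉ : x ∉ S → isClosedAt (suc i) S ≡ isClosedAt i S
    isClosedAt-∉ x∉S = cong₂ _∧_ (meetsPrefix-∉ x∉S) (withinPrefix-∉ x∉S)

    isOpenedAt-∉ : x ∉ S → isOpenedAt (suc i) S ≡ isOpenedAt i S
    isOpenedAt-∉ x∉S = cong₂ (λ a b → a ∧ not b) (meetsPrefix-∉ x∉S) (withinPrefix-∉ x∉S)

-- Move m e s t: an edge s → t of D_k taken when the block of the new element meets the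
-- previous prefix iff m, and is contained in the new prefix iff e.
data Move : Bool → Bool → ℕ × ℕ → ℕ × ℕ → Set where
  new   : ∀ {c o} → Move false true  (c , o)     (suc c , o)
  open′ : ∀ {c o} → Move false false (c , o)     (c , suc o)
  loop  : ∀ {c o} → Move true  false (c , suc o) (c , suc o)
  close : ∀ {c o} → Move true  true  (c , suc o) (suc c , o)

Move⇒Step : ∀ {m e s t} → Move m e s t → Step s t
Move⇒Step new = new
Move⇒Step open′ = open′
Move⇒Step loop = loop
Move⇒Step close = close

Move-functional : ∀ {m e s t t′} → Move m e s t → Move m e s t′ → t ≡ t′
Move-functional new new = refl
Move-functional open′ open′ = refl
Move-functional loop loop = refl
Move-functional close close = refl

Move-cast : ∀ {m m′ e e′ s t} → m′ ≡ m → e′ ≡ e → Move m e s t → Move m′ e′ s t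
Move-cast refl refl mv = mv

size : ℕ × ℕ → ℕ
size (c , o) = c + o

joins? : ℕ × ℕ → ℕ × ℕ → Bool
joins? s t = size s ≡ᵇ size t

ends? : ℕ × ℕ → ℕ × ℕ → Bool
ends? s t = not (proj₁ s ≡ᵇ proj₁ t)

Step⇒Move : ∀ {s t} → Step s t → Move (joins? s t) (ends? s t) s t
Step⇒Move (loop {c} {o}) = Move-cast (≡ᵇ-true {c + suc o} refl) (cong not (≡ᵇ-true {c} refl)) loop
Step⇒Move (open′ {c} {o}) =
  Move-cast (≡ᵇ-false (<⇒≢ (+-monoʳ-< c (n<1+n o)))) (cong not (≡ᵇ-true {c} refl)) open′
Step⇒Move (new {c} {o}) = Move-cast (≡ᵇ-false (<⇒≢ (n<1+n (c + o)))) (cong not (≡ᵇ-false (<⇒≢ (n<1+n c)))) new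
Step⇒Move (close {c} {o}) = Move-cast (≡ᵇ-true (+-suc c o)) (cong not (≡ᵇ-false (<⇒≢ (n<1+n c)))) close

Move-fresh-size : ∀ {e s t} → Move false e s t → size t ≡ suc (size s)
Move-fresh-size new = refl
Move-fresh-size (open′ {c} {o}) = +-suc c o

Move-join-size : ∀ {e s t} → Move true e s t → size t ≡ size s
Move-join-size loop = refl
Move-join-size (close {c} {o}) = sym (+-suc c o)

Move-fresh-open : ∀ {e s t} → Move false e s t → proj₂ t ≡ proj₂ s + bit (not e)
Move-fresh-open (new {o = o}) = sym (+-identityʳ o)
Move-fresh-open (open′ {o = o}) = +-comm 1 o

Move-join-open : ∀ {e s t} → Move true e s t → bit (not e) + proj₂ s ≡ suc (proj₂ t)
Move-join-open loop = refl
Move-join-open close = refl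

Move-join-open>0 : ∀ {e s t} → Move true e s t → 0 < proj₂ s
Move-join-open>0 loop = s≤s z≤n
Move-join-open>0 close = s≤s z≤n

closedAt : ∀ {n k} → ℕ → OrderedPartition n k → Fin k → Bool
closedAt i π j = isClosedAt i (block π j)

openedAt : ∀ {n k} → ℕ → OrderedPartition n k → Fin k → Bool
openedAt i π j = isOpenedAt i (block π j)

F≡counts : ∀ {n k} i (π : OrderedPartition n k) → F i π ≡ (count (closedAt i π) , count (openedAt i π))
F≡counts i π = cong₂ _,_ (length-filterᵇ-tabulate (closedAt i π) id) (length-filterᵇ-tabulate (openedAt i π) id)

move-from-counts : ∀ m e {c o c′ o′} → bit e + c ≡ c′ → bit (not e) + o ≡ bit m + o′ → (m ≡ true → 0 < o) →
  Move m e (c , o) (c′ , o′)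
move-from-counts false true  refl refl _ = new
move-from-counts false false refl refl _ = open′
move-from-counts true  false refl refl o>0 with o>0 refl
... | s≤s z≤n = loop
move-from-counts true  true  refl refl _ = close

F-move : ∀ {n k} (π : OrderedPartition n k) i (x : Fin n) → toℕ x ≡ i → ∀ {j} → x ∈ block π j →
  Move (meetsPrefix i (block π j)) (withinPrefix (suc i) (block π j)) (F i π) (F (suc i) π)
F-move π i x x≡i {j} x∈B =
  subst₂ (Move m e) (sym (F≡counts i π)) (sym (F≡counts (suc i) π))
    (move-from-counts m e closed-step opened-step (λ m≡true → witness⇒count>0 _ j (trans opened-before m≡true)))
  where
  B : Subset _
  B = block π j
  m e : Bool
  m = meetsPrefix i B
  e = withinPrefix (suc i) B
  x∉others : ∀ {j′} → j′ ≢ j → x ∉ block π j′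
  x∉others j′≢j = disjoint π _ _ (j′≢j ∘ sym) x x∈B
  meets-after : meetsPrefix (suc i) B ≡ true
  meets-after = meetsPrefix-∈ B x x≡i x∈B
  within-before : withinPrefix i B ≡ false
  within-before = withinPrefix-∈ B x x≡i x∈B
  closed-before : closedAt i π j ≡ false
  closed-before = trans (cong (m ∧_) within-before) (∧-zeroʳ m)
  opened-before : openedAt i π j ≡ m
  opened-before = trans (cong (λ b → m ∧ not b) within-before) (∧-identityʳ m)
  closed-step : bit e + count (closedAt i π) ≡ count (closedAt (suc i) π)
  closed-step = subst₂ (λ a b → bit a + count (closedAt i π) ≡ bit b + count (closedAt (suc i) π))
    (cong (_∧ e) meets-after) closed-before
    (count-swap _ _ j λ j′ j′≢j → sym (isClosedAt-∉ _ x x≡i (x∉others j′≢j)))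
  opened-step : bit (not e) + count (openedAt i π) ≡ bit m + count (openedAt (suc i) π)
  opened-step = subst₂ (λ a b → bit a + count (openedAt i π) ≡ bit b + count (openedAt (suc i) π))
    (cong (_∧ not e) meets-after) opened-before
    (count-swap _ _ j λ j′ j′≢j → sym (isOpenedAt-∉ _ x x≡i (x∉others j′≢j)))

closed∧opened≡false : ∀ a b → (a ∧ b) ∧ (a ∧ not b) ≡ false
closed∧opened≡false false b = refl
closed∧opened≡false true false = refl
closed∧opened≡false true true = refl

F-vertex : ∀ {n k} i (π : OrderedPartition n k) → Vertex k (F i π)
F-vertex i π = subst (Vertex _) (sym (F≡counts i π))
  (count-disjoint _ _ λ j → closed∧opened≡false (meetsPrefix i (block π j)) (withinPrefix i (block π j)))

F-zero : ∀ {n k} (π : OrderedPartition n k) → F 0 π ≡ (0 , 0)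
F-zero π = trans (F≡counts 0 π) (cong₂ _,_
  (count-false _ λ j → cong (_∧ withinPrefix 0 (block π j)) (meets-nothing j))
  (count-false _ λ j → cong (_∧ not (withinPrefix 0 (block π j))) (meets-nothing j)))
  where
  meets-nothing : ∀ j → meetsPrefix 0 (block π j) ≡ false
  meets-nothing j = meetsPrefix-none (block π j) {0} λ x ()

F-last : ∀ {n k} (π : OrderedPartition n k) → F n π ≡ (k , 0)
F-last {n} π = trans (F≡counts n π) (cong₂ _,_
  (count-true _ λ j → cong₂ _∧_ (meets-all j) (within-all j))
  (count-false _ λ j → cong₂ (λ a b → a ∧ not b) (meets-all j) (within-all j)))
  where
  meets-all : ∀ j → meetsPrefix n (block π j) ≡ true
  meets-all j = let x , x∈B = nonempty π j in meetsPrefix-intro (block π j) x (toℕ<n x) x∈B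
  within-all : ∀ j → withinPrefix n (block π j) ≡ true
  within-all j = withinPrefix-intro (block π j) λ x _ → toℕ<n x

last-tabulate : ∀ {A : Set} {n} (f : Fin (suc n) → A) → last (tabulate f) ≡ f (fromℕ n)
last-tabulate {n = zero} f = refl
last-tabulate {n = suc n} f = last-tabulate (f ∘ Fin.suc)

form-isPath : ∀ {n k} (π : OrderedPartition n k) → IsPath k n (form π)
form-isPath {n} {k} π =
    (λ i → subst (Vertex k) (sym (lookup-form i)) (F-vertex (toℕ i) π))
  , F-zero π
  , trans (last-tabulate {n = n} (λ i → F (toℕ i) π)) (trans (cong (λ i → F i π) (toℕ-fromℕ n)) (F-last π))
  , λ i → subst₂ (Edge k) (sym (trans (lookup-form (inject₁ i)) (cong (λ i → F i π) (toℕ-inject₁ i))))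
                          (sym (lookup-form (Fin.suc i))) (edge i)
  where
  edge : ∀ (i : Fin n) → Edge k (F (toℕ i) π) (F (suc (toℕ i)) π)
  edge i = F-vertex (toℕ i) π , F-vertex (suc (toℕ i)) π , Move⇒Step (F-move π (toℕ i) i refl (proj₂ (covers π i)))
  lookup-form : ∀ i → lookup (form π) i ≡ F (toℕ i) π
  lookup-form = lookup∘tabulate (λ i → F (toℕ i) π)

fibre : ∀ {n k} → (Fin n → Fin k) → Fin k → Subset n
fibre f j = tabulate λ x → does (f x Fin.≟ j)

module _ {n k} (f : Fin n → Fin k) {x : Fin n} {j : Fin k} where

  ∈-fibre⁺ : f x ≡ j → x ∈ fibre f j
  ∈-fibre⁺ fx≡j = lookup⇒[]= x _ (trans (lookup∘tabulate _ x) (dec-true (f x Fin.≟ j) fx≡j))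

  ∈-fibre⁻ : x ∈ fibre f j → f x ≡ j
  ∈-fibre⁻ x∈ with f x Fin.≟ j | trans (sym (lookup∘tabulate _ x)) ([]=⇒lookup x∈)
  ... | yes fx≡j | _ = fx≡j
  ... | no _ | ()

partitionOf : ∀ {n k} (f : Fin n → Fin k) → (∀ j → ∃ λ x → f x ≡ j) → OrderedPartition n k
partitionOf f onto = record
  { block = fibre f
  ; nonempty = λ j → let x , fx≡j = onto j in x , ∈-fibre⁺ f fx≡j
  ; disjoint = λ j j′ j≢j′ x x∈j x∈j′ → j≢j′ (trans (sym (∈-fibre⁻ f x∈j)) (∈-fibre⁻ f x∈j′))
  ; covers = λ x → f x , ∈-fibre⁺ f refl
  }

lookupℕ : ∀ {A : Set} {n} → Vec A (suc n) → ℕ → A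
lookupℕ (x ∷ []) _ = x
lookupℕ (x ∷ y ∷ ys) zero = x
lookupℕ (x ∷ y ∷ ys) (suc i) = lookupℕ (y ∷ ys) i

lookup≡lookupℕ : ∀ {A : Set} {n} (s : Vec A (suc n)) i → lookup s i ≡ lookupℕ s (toℕ i)
lookup≡lookupℕ (x ∷ []) Fin.zero = refl
lookup≡lookupℕ (x ∷ y ∷ ys) Fin.zero = refl
lookup≡lookupℕ (x ∷ y ∷ ys) (Fin.suc i) = lookup≡lookupℕ (y ∷ ys) i

head≡lookupℕ : ∀ {A : Set} {n} (s : Vec A (suc n)) → head s ≡ lookupℕ s 0
head≡lookupℕ (x ∷ []) = refl
head≡lookupℕ (x ∷ y ∷ ys) = refl

last≡lookupℕ : ∀ {A : Set} {n} (s : Vec A (suc n)) → last s ≡ lookupℕ s n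
last≡lookupℕ (x ∷ []) = refl
last≡lookupℕ (x ∷ y ∷ ys) = last≡lookupℕ (y ∷ ys)

update : {A : Set} → (ℕ → A) → ℕ → A → ℕ → A
update f p v y = if y ≡ᵇ p then v else f y

update-≡ : ∀ {A : Set} (f : ℕ → A) {p v} → update f p v p ≡ v
update-≡ f {p} rewrite ≡ᵇ-true (refl {x = p}) = refl

update-≢ : ∀ {A : Set} (f : ℕ → A) {p v y} → y ≢ p → update f p v y ≡ f y
update-≢ f y≢p rewrite ≡ᵇ-false y≢p = refl

module FromMoves (n : ℕ) (J E : ℕ → Bool) (σ : ℕ → ℕ × ℕ) (σ₀ : σ 0 ≡ (0 , 0))
  (moves : ∀ i → i < n → Move (J i) (E i) (σ i) (σ (suc i))) where

  -- label y (for y < p) is the block of the element y + 1, blocks being numbered 0, 1, …;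
  -- isOpen marks the blocks that will still receive elements.
  record Labelling (p : ℕ) : Set where
    field
      blocks : ℕ
      label : ℕ → ℕ
      isOpen : ℕ → Bool
      blocks≡size : blocks ≡ size (σ p)
      label<blocks : ∀ y → y < p → label y < blocks
      label-onto : ∀ l → l < blocks → ∃ λ y → y < p × label y ≡ l
      open-count : count {blocks} (isOpen ∘ toℕ) ≡ proj₂ (σ p)
      join⇒seen : ∀ i → i < p → J i ≡ true → ∃ λ y → y < i × label y ≡ label i
      fresh⇒unseen : ∀ i → i < p → J i ≡ false → ∀ y → y < i → label y ≢ label i
      end⇒finished : ∀ i → i < p → E i ≡ true →
        isOpen (label i) ≡ false × (∀ y → i < y → y < p → label y ≢ label i)
      ¬end⇒continues : ∀ i → i < p → E i ≡ false →
        isOpen (label i) ≡ true ⊎ ∃ λ y → i < y × y < p × label y ≡ label i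

  initial : Labelling 0
  initial = record
    { blocks = 0 ; label = λ _ → 0 ; isOpen = λ _ → false
    ; blocks≡size = sym (cong size σ₀)
    ; label<blocks = λ _ ()
    ; label-onto = λ _ ()
    ; open-count = sym (cong proj₂ σ₀)
    ; join⇒seen = λ _ ()
    ; fresh⇒unseen = λ _ ()
    ; end⇒finished = λ _ ()
    ; ¬end⇒continues = λ _ ()
    }

  module Assign {p} (L : Labelling p) (l : ℕ) where
    open Labelling L

    label′ : ℕ → ℕ
    label′ = update label p l

    isOpen′ : ℕ → Bool
    isOpen′ = update isOpen l (not (E p))

    label′-old : ∀ {y} → y < p → label′ y ≡ label y
    label′-old y<p = update-≢ label (<⇒≢ y<p)

    label′-new : label′ p ≡ l
    label′-new = update-≡ label

    join⇒seen′ : (J p ≡ true → ∃ λ y → y < p × label y ≡ l) →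
      ∀ i → i < suc p → J i ≡ true → ∃ λ y → y < i × label′ y ≡ label′ i
    join⇒seen′ seen i i<1+p Ji with m<1+n⇒m<n∨m≡n i<1+p
    ... | inj₁ i<p = let y , y<i , same = join⇒seen i i<p Ji in
      y , y<i , trans (label′-old (<-trans y<i i<p)) (trans same (sym (label′-old i<p)))
    ... | inj₂ refl = let y , y<p , same = seen Ji in
      y , y<p , trans (label′-old y<p) (trans same (sym label′-new))

    fresh⇒unseen′ : (J p ≡ false → ∀ y → y < p → label y ≢ l) →
      ∀ i → i < suc p → J i ≡ false → ∀ y → y < i → label′ y ≢ label′ i
    fresh⇒unseen′ unseen i i<1+p Ji y y<i same with m<1+n⇒m<n∨m≡n i<1+p
    ... | inj₁ i<p = fresh⇒unseen i i<p Ji y y<i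
      (trans (sym (label′-old (<-trans y<i i<p))) (trans same (label′-old i<p)))
    ... | inj₂ refl = unseen Ji y y<i (trans (sym (label′-old y<i)) (trans same label′-new))

    end⇒finished′ : (∀ i → i < p → E i ≡ true → label i ≢ l) →
      ∀ i → i < suc p → E i ≡ true → isOpen′ (label′ i) ≡ false × (∀ y → i < y → y < suc p → label′ y ≢ label′ i)
    end⇒finished′ ended≢l i i<1+p Ei with m<1+n⇒m<n∨m≡n i<1+p
    ... | inj₁ i<p = trans (cong isOpen′ (label′-old i<p)) (trans (update-≢ isOpen (ended≢l i i<p Ei)) closed) , later
      where
      closed = proj₁ (end⇒finished i i<p Ei)
      later : ∀ y → i < y → y < suc p → label′ y ≢ label′ i
      later y i<y y<1+p same with m<1+n⇒m<n∨m≡n y<1+p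
      ... | inj₁ y<p = proj₂ (end⇒finished i i<p Ei) y i<y y<p
        (trans (sym (label′-old y<p)) (trans same (label′-old i<p)))
      ... | inj₂ refl = ended≢l i i<p Ei (trans (sym (label′-old i<p)) (trans (sym same) label′-new))
    ... | inj₂ refl = trans (cong isOpen′ label′-new) (trans (update-≡ isOpen) (cong not Ei)) ,
      λ y p<y y<1+p → contradiction y<1+p (≤⇒≯ p<y)

    ¬end⇒continues′ : ∀ i → i < suc p → E i ≡ false →
      isOpen′ (label′ i) ≡ true ⊎ ∃ λ y → i < y × y < suc p × label′ y ≡ label′ i
    ¬end⇒continues′ i i<1+p Ei with m<1+n⇒m<n∨m≡n i<1+p
    ... | inj₂ refl = inj₁ (trans (cong isOpen′ label′-new) (trans (update-≡ isOpen) (cong not Ei)))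
    ... | inj₁ i<p with ¬end⇒continues i i<p Ei
    ...   | inj₂ (y , i<y , y<p , same) =
      inj₂ (y , i<y , m<n⇒m<1+n y<p , trans (label′-old y<p) (trans same (sym (label′-old i<p))))
    ...   | inj₁ open-i with label i ≟ l
    ...     | yes i↦l = inj₂ (p , i<p , n<1+n p , trans label′-new (trans (sym i↦l) (sym (label′-old i<p))))
    ...     | no i↛l = inj₁ (trans (cong isOpen′ (label′-old i<p)) (trans (update-≢ isOpen i↛l) open-i))

  extend-fresh : ∀ {p} → Labelling p → J p ≡ false → Move false (E p) (σ p) (σ (suc p)) → Labelling (suc p)
  extend-fresh {p} L Jp mv = record
    { blocks = suc blocks ; label = label′ ; isOpen = isOpen′
    ; blocks≡size = trans (cong suc blocks≡size) (sym (Move-fresh-size mv))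
    ; label<blocks = label′<blocks
    ; label-onto = label′-onto
    ; open-count = open-count′
    ; join⇒seen = join⇒seen′ λ Jp≡true → contradiction (trans (sym Jp≡true) Jp) λ ()
    ; fresh⇒unseen = fresh⇒unseen′ λ _ y y<p → <⇒≢ (label<blocks y y<p)
    ; end⇒finished = end⇒finished′ λ i i<p _ → <⇒≢ (label<blocks i i<p)
    ; ¬end⇒continues = ¬end⇒continues′
    }
    where
    open Labelling L
    open Assign L blocks
    label′<blocks : ∀ y → y < suc p → label′ y < suc blocks
    label′<blocks y y<1+p with m<1+n⇒m<n∨m≡n y<1+p
    ... | inj₁ y<p = subst (_< suc blocks) (sym (label′-old y<p)) (m<n⇒m<1+n (label<blocks y y<p))
    ... | inj₂ refl = subst (_< suc blocks) (sym label′-new) (n<1+n blocks)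
    label′-onto : ∀ l → l < suc blocks → ∃ λ y → y < suc p × label′ y ≡ l
    label′-onto l l<1+b with m<1+n⇒m<n∨m≡n l<1+b
    ... | inj₁ l<b = let y , y<p , y↦l = label-onto l l<b in
      y , m<n⇒m<1+n y<p , trans (label′-old y<p) y↦l
    ... | inj₂ refl = p , n<1+n p , label′-new
    open-count′ : count {suc blocks} (isOpen′ ∘ toℕ) ≡ proj₂ (σ (suc p))
    open-count′ = begin
      count {suc blocks} (isOpen′ ∘ toℕ)                         ≡⟨ count-snoc {blocks} (isOpen′ ∘ toℕ) ⟩
      count {blocks} (isOpen′ ∘ toℕ ∘ inject₁) + bit (isOpen′ (toℕ (fromℕ blocks)))
        ≡⟨ cong₂ _+_ (count-cong old-flags) (cong bit (trans (cong isOpen′ (toℕ-fromℕ blocks)) (update-≡ isOpen))) ⟩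
      count {blocks} (isOpen ∘ toℕ) + bit (not (E p))            ≡⟨ cong (_+ _) open-count ⟩
      proj₂ (σ p) + bit (not (E p))                              ≡⟨ Move-fresh-open mv ⟨
      proj₂ (σ (suc p))                                          ∎
      where
      open ≡-Reasoning
      old-flags : ∀ j → isOpen′ (toℕ (inject₁ j)) ≡ isOpen (toℕ j)
      old-flags j rewrite toℕ-inject₁ j = update-≢ isOpen (<⇒≢ (toℕ<n j))

  extend-reuse : ∀ {p} (L : Labelling p) → J p ≡ true → ∀ l → l < Labelling.blocks L → Labelling.isOpen L l ≡ true →
    Move true (E p) (σ p) (σ (suc p)) → Labelling (suc p)
  extend-reuse {p} L Jp l l<b open-l mv = record
    { blocks = blocks ; label = label′ ; isOpen = isOpen′
    ; blocks≡size = trans blocks≡size (sym (Move-join-size mv))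
    ; label<blocks = label′<blocks
    ; label-onto = λ l′ l′<b → let y , y<p , y↦l′ = label-onto l′ l′<b in
        y , m<n⇒m<1+n y<p , trans (label′-old y<p) y↦l′
    ; open-count = suc-injective (trans (sym swapped) (Move-join-open mv))
    ; join⇒seen = join⇒seen′ λ _ → label-onto l l<b
    ; fresh⇒unseen = fresh⇒unseen′ λ Jp≡false → contradiction (trans (sym Jp) Jp≡false) λ ()
    ; end⇒finished = end⇒finished′ λ i i<p Ei i↦l →
        contradiction (trans (sym (proj₁ (end⇒finished i i<p Ei))) (trans (cong isOpen i↦l) open-l)) λ ()
    ; ¬end⇒continues = ¬end⇒continues′
    }
    where
    open Labelling L
    open Assign L l
    label′<blocks : ∀ y → y < suc p → label′ y < blocks
    label′<blocks y y<1+p with m<1+n⇒m<n∨m≡n y<1+p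
    ... | inj₁ y<p = subst (_< blocks) (sym (label′-old y<p)) (label<blocks y y<p)
    ... | inj₂ refl = subst (_< blocks) (sym label′-new) l<b
    swapped : bit (not (E p)) + proj₂ (σ p) ≡ suc (count {blocks} (isOpen′ ∘ toℕ))
    swapped = subst₂ (λ a b → bit a + proj₂ (σ p) ≡ bit b + count {blocks} (isOpen′ ∘ toℕ))
      (trans (cong isOpen′ (toℕ-fromℕ< l<b)) (update-≡ isOpen)) (trans (cong isOpen (toℕ-fromℕ< l<b)) open-l)
      (subst (λ c → bit (isOpen′ (toℕ (fromℕ< l<b))) + c ≡ bit (isOpen (toℕ (fromℕ< l<b))) + count {blocks} (isOpen′ ∘ toℕ)) open-count
        (count-swap (isOpen ∘ toℕ) (isOpen′ ∘ toℕ) (fromℕ< l<b) λ j j≢l →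
          sym (update-≢ isOpen (j≢l ∘ toℕ-injective ∘ flip trans (sym (toℕ-fromℕ< l<b))))))

  extend : ∀ p → p < n → Labelling p → Labelling (suc p)
  extend p p<n L with J p in Jp | moves p p<n
  ... | false | mv = extend-fresh L Jp mv
  ... | true  | mv = extend-reuse L Jp (toℕ j) (toℕ<n j) open-j mv
    where
    open Labelling L
    open-block = count>0⇒witness {blocks} (isOpen ∘ toℕ) (subst (0 <_) (sym open-count) (Move-join-open>0 mv))
    j = proj₁ open-block
    open-j = proj₂ open-block

  labelling : ∀ p → p ≤ n → Labelling p
  labelling zero _ = initial
  labelling (suc p) p<n = extend p p<n (labelling p (<⇒≤ p<n))

module FromPath {n k} (s : Vec (ℕ × ℕ) (suc n)) (path : IsPath k n s) where

  σ : ℕ → ℕ × ℕ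
  σ = lookupℕ s

  σ₀ : σ 0 ≡ (0 , 0)
  σ₀ = trans (sym (head≡lookupℕ s)) (proj₁ (proj₂ path))

  σₙ : σ n ≡ (k , 0)
  σₙ = trans (sym (last≡lookupℕ s)) (proj₁ (proj₂ (proj₂ path)))

  step : ∀ i → i < n → Step (σ i) (σ (suc i))
  step i i<n = subst₂ Step
    (trans (lookup≡lookupℕ s (inject₁ f)) (cong σ (trans (toℕ-inject₁ f) (toℕ-fromℕ< i<n))))
    (trans (lookup≡lookupℕ s (Fin.suc f)) (cong (σ ∘ suc) (toℕ-fromℕ< i<n)))
    (proj₂ (proj₂ (proj₂ (proj₂ (proj₂ path)) f)))
    where f = fromℕ< i<n

  J E : ℕ → Bool
  J i = joins? (σ i) (σ (suc i))
  E i = ends? (σ i) (σ (suc i))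

  moves : ∀ i → i < n → Move (J i) (E i) (σ i) (σ (suc i))
  moves i i<n = Step⇒Move (step i i<n)

  open FromMoves n J E σ σ₀ moves using (Labelling; labelling)
  open Labelling (labelling n ≤-refl)

  blocks≡k : blocks ≡ k
  blocks≡k = trans blocks≡size (trans (cong size σₙ) (+-identityʳ k))

  all-closed : ∀ i → i < n → isOpen (label i) ≡ false
  all-closed i i<n = subst (λ l → isOpen l ≡ false) (toℕ-fromℕ< (label<blocks i i<n))
    (count≡0⇒false (isOpen ∘ toℕ) (trans open-count (cong proj₂ σₙ)) (fromℕ< (label<blocks i i<n)))

  labelFin : Fin n → Fin k
  labelFin x = fromℕ< (subst (label (toℕ x) <_) blocks≡k (label<blocks (toℕ x) (toℕ<n x)))

  toℕ-labelFin : ∀ x → toℕ (labelFin x) ≡ label (toℕ x)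
  toℕ-labelFin x = toℕ-fromℕ< _

  labelFin-onto : ∀ j → ∃ λ x → labelFin x ≡ j
  labelFin-onto j =
    let y , y<n , y↦j = label-onto (toℕ j) (subst (toℕ j <_) (sym blocks≡k) (toℕ<n j)) in
    fromℕ< y<n , toℕ-injective (trans (toℕ-labelFin _) (trans (cong label (toℕ-fromℕ< y<n)) y↦j))

  π : OrderedPartition n k
  π = partitionOf labelFin labelFin-onto

  ∈-block⁺ : ∀ {x j} → label (toℕ x) ≡ toℕ j → x ∈ block π j
  ∈-block⁺ x↦j = ∈-fibre⁺ labelFin (toℕ-injective (trans (toℕ-labelFin _) x↦j))

  ∈-block⁻ : ∀ {x j} → x ∈ block π j → label (toℕ x) ≡ toℕ j
  ∈-block⁻ x∈j = trans (sym (toℕ-labelFin _)) (cong toℕ (∈-fibre⁻ labelFin x∈j))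

  meets-own-block : ∀ i → i < n → ∀ j → toℕ j ≡ label i → meetsPrefix i (block π j) ≡ J i
  meets-own-block i i<n j j≡ with J i in Ji
  ... | true = let y , y<i , same = join⇒seen i i<n Ji
                   y<n = <-trans y<i i<n in
    meetsPrefix-intro _ (fromℕ< y<n) (subst (_< i) (sym (toℕ-fromℕ< y<n)) y<i)
      (∈-block⁺ (trans (cong label (toℕ-fromℕ< y<n)) (trans same (sym j≡))))
  ... | false = meetsPrefix-none _ λ y y<i y∈j → fresh⇒unseen i i<n Ji (toℕ y) y<i (trans (∈-block⁻ y∈j) j≡)

  within-own-block : ∀ i → i < n → ∀ j → toℕ j ≡ label i → withinPrefix (suc i) (block π j) ≡ E i
  within-own-block i i<n j j≡ with E i in Ei
  ... | true = withinPrefix-intro _ inside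
    where
    inside : ∀ y → y ∈ block π j → toℕ y < suc i
    inside y y∈j with toℕ y <? suc i
    ... | yes y≤i = y≤i
    ... | no y≰i = contradiction (trans (∈-block⁻ y∈j) j≡)
      (proj₂ (end⇒finished i i<n Ei) (toℕ y) (≮⇒≥ y≰i) (toℕ<n y))
  ... | false with ¬end⇒continues i i<n Ei
  ...   | inj₁ open-i = contradiction (trans (sym open-i) (all-closed i i<n)) λ ()
  ...   | inj₂ (y , i<y , y<n , same) = withinPrefix-escape _ (fromℕ< y<n)
    (subst (suc i ≤_) (sym (toℕ-fromℕ< y<n)) i<y)
    (∈-block⁺ (trans (cong label (toℕ-fromℕ< y<n)) (trans same (sym j≡))))

  F≡σ : ∀ i → i ≤ n → F i π ≡ σ i
  F≡σ zero _ = trans (F-zero π) (sym σ₀)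
  F≡σ (suc i) i<n = Move-functional realised (moves i i<n)
    where
    x = fromℕ< i<n
    x≡i = toℕ-fromℕ< i<n
    j≡ : toℕ (labelFin x) ≡ label i
    j≡ = trans (toℕ-labelFin x) (cong label x≡i)
    realised : Move (J i) (E i) (σ i) (F (suc i) π)
    realised = subst (λ t → Move (J i) (E i) t (F (suc i) π)) (F≡σ i (<⇒≤ i<n))
      (Move-cast (sym (meets-own-block i i<n _ j≡)) (sym (within-own-block i i<n _ j≡))
        (F-move π i x x≡i (∈-fibre⁺ labelFin refl)))

  form≡s : form π ≡ s
  form≡s = trans (tabulate-cong λ i → trans (F≡σ (toℕ i) (m<1+n⇒m≤n (toℕ<n i))) (sym (lookup≡lookupℕ s i)))
                 (tabulate∘lookup s)

proposition3p3 : ∀ (n k : ℕ) → k ≤ n → (s : Vec (ℕ × ℕ) (suc n)) →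
    (∃ λ (π : OrderedPartition n k) → form π ≡ s) ⇔ IsPath k n s
proposition3p3 n k _ s = mk⇔ (λ { (π , refl) → form-isPath π }) (λ path → FromPath.π s path , FromPath.form≡s s path)
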